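{- Let $q$ be a prime power, $\alpha$ a primitive element of $\mathbb{F}_{q^5}$, and $s=\frac{q^5-1}{q-1}$. For every integer $i$ with $1\le i\le s-1$, the elements $\alpha^0,\alpha^i,\alpha^{2i}$ are linearly independent over $\mathbb{F}_q$. -}

module Defs where

open import Level using (Level; _⊔_; suc)
open import Data.Nat as ℕ using (ℕ; zero; _∸_; _≤_)
import Data.Nat.Primality as P
open import Data.Nat.DivMod using (_/_)
open import Data.Fin using (Fin)
open import Data.Product using (Σ; ∃; ∃-syntax; _×_; _,_; proj₁)
open import Relation.Nullary using (¬_)
open import Relation.Binary.PropositionalEquality using (_≡_) renaming (setoid to ≡-setoid)
open import Relation.Binary.Bundles using (Setoid)
open import Algebra.Bundles using (CommutativeRing)
open import Function.Bundles using (Bijection)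

IsPrimePower : ℕ → Set
IsPrimePower q = ∃[ p ] ∃[ k ] (P.Prime p × 1 ≤ k × q ≡ p ℕ.^ k)

-- s = (q^5 - 1)/(q - 1); the degenerate cases q = 0,1 never occur for prime powers
s : ℕ → ℕ
s zero = zero
s (ℕ.suc zero) = zero
s q@(ℕ.suc (ℕ.suc m)) = (q ℕ.^ 5 ∸ 1) / ℕ.suc m

record Field (c ℓ : Level) : Set (suc (c ⊔ ℓ)) where
  field
    commutativeRing : CommutativeRing c ℓ
  open CommutativeRing commutativeRing public
  field
    0≉1     : ¬ (0# ≈ 1#)
    inverse : ∀ x → ¬ (x ≈ 0#) → ∃[ y ] (x * y ≈ 1#)

module _ {c ℓ : Level} (K : Field c ℓ) where
  open Field K

  pow : Carrier → ℕ → Carrier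
  pow x zero = 1#
  pow x (ℕ.suc n) = x * pow x n

  SubSetoid : (S : Carrier → Set ℓ) → Setoid _ _
  SubSetoid S = record
    { Carrier = Σ Carrier S
    ; _≈_ = λ x y → proj₁ x ≈ proj₁ y
    ; isEquivalence = record
      { refl = refl ; sym = sym ; trans = trans } }

  HasCard : ℕ → Set _
  HasCard n = Bijection (≡-setoid (Fin n)) setoid

  record IsSubfield (S : Carrier → Set ℓ) : Set (c ⊔ ℓ) where
    field
      resp  : ∀ {x y} → x ≈ y → S x → S y
      has0  : S 0#
      has1  : S 1#
      +-closed : ∀ {x y} → S x → S y → S (x + y)
      neg-closed : ∀ {x} → S x → S (- x)
      *-closed : ∀ {x y} → S x → S y → S (x * y)
      inv-closed : ∀ {x y} → S x → x * y ≈ 1# → S y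

  record IsSubfieldOfCard (S : Carrier → Set ℓ) (n : ℕ) : Set (c ⊔ ℓ) where
    field
      isSubfield : IsSubfield S
      card : Bijection (≡-setoid (Fin n)) (SubSetoid S)

  IsPrimitive : Carrier → Set (c ⊔ ℓ)
  IsPrimitive α = ¬ (α ≈ 0#) × (∀ x → ¬ (x ≈ 0#) → ∃[ k ] (x ≈ pow α k))

  LinIndep3 : (S : Carrier → Set ℓ) → Carrier → Carrier → Carrier → Set (c ⊔ ℓ)
  LinIndep3 S x y z = ∀ a b d → S a → S b → S d →
    (a * x + b * y + d * z) ≈ 0# → (a ≈ 0#) × (b ≈ 0#) × (d ≈ 0#)

-- Write r = q - 1 and s = 1 + q + q² + q³ + q⁴, so that |F_{q⁵}*| = q⁵ - 1 = r·s, and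
-- let β = αⁱ with 1 ≤ i < s.  The only group-theoretic tool is Lagrange's theorem in the
-- form: if multiplication by β ≠ 0 maps a finite set P into itself and P has n nonzero
-- elements, then βⁿ = 1 (it permutes them; compare the products).  Since α has order r·s,
-- βⁿ = 1 forces r·s ∣ n·i.
--   * β ∉ F_q: otherwise β^r = 1, so s ∣ i, impossible for 0 < i < s.
--   * β is not quadratic over F_q: if β² = u + vβ then the span F_q + F_q β has q²
--     elements (as β ∉ F_q) and is closed under multiplication by β, so β^(q²-1) = 1,
--     hence s ∣ (q + 1)·i; but s = (q + 1)(q³ + q) + 1 is coprime to q + 1, so s ∣ i.
module Submission where

open import Defs
open import Level using (Level; _⊔_)
open import Data.Nat using (ℕ; _≤_; _*_; _^_; _∸_)
import Data.Nat as ℕ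
import Data.Nat.Properties as ℕ
open import Data.Nat.DivMod using (_/_; _%_; m≡m%n+[m/n]*n; m%n<n; m*n/n≡m)
open import Data.Nat.Divisibility using (_∣_; m%n≡0⇒n∣m; *-cancelˡ-∣; ∣⇒≤; 0∣⇒≡0; ∣1⇒≡1; ∣m+n∣m⇒∣n; ∣-trans; m∣m*n)
open import Data.Nat.Coprimality using (Coprime; coprime-divisor)
open import Data.Nat.Primality using (prime⇒nonTrivial)
open import Data.Nat.Tactic.RingSolver using (solve-∀)
open import Data.Fin as Fin using (Fin; punchIn; punchOut; remQuot; combine)
import Data.Fin.Properties as Fin
open import Data.Fin.Permutation using (Permutation; permutation)
open import Data.Product using (∃-syntax; _×_; _,_; proj₁; proj₂; uncurry)
open import Data.Unit using (⊤; tt)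
open import Data.Empty using (⊥-elim)
open import Function using (_∘_; Injective)
open import Function.Bundles using (Bijection)
open import Relation.Nullary using (¬_; yes; no; contradiction)
open import Relation.Binary.Definitions using (Decidable)
open import Relation.Binary.PropositionalEquality as ≡ using (_≡_; _≢_)

-- Arithmetic of q

-- s = 1 + q + q² + q³ + q⁴, the number written (q⁵ - 1)/(q - 1) in the paper
repunit5 : ℕ → ℕ
repunit5 q = 1 ℕ.+ q ℕ.+ q ^ 2 ℕ.+ q ^ 3 ℕ.+ q ^ 4

-- q⁵ - 1 = (q - 1)·s, with r = q - 1 (the ring solver is run on the unfolded powers)
q⁵≡1+r*s : ∀ r → ℕ.suc r ^ 5 ≡ ℕ.suc (r * repunit5 (ℕ.suc r))
q⁵≡1+r*s = expanded
  where
  expanded : ∀ r → (1 ℕ.+ r) * ((1 ℕ.+ r) * ((1 ℕ.+ r) * ((1 ℕ.+ r) * ((1 ℕ.+ r) * 1))))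
    ≡ 1 ℕ.+ r * (1 ℕ.+ (1 ℕ.+ r) ℕ.+ (1 ℕ.+ r) * ((1 ℕ.+ r) * 1)
                  ℕ.+ (1 ℕ.+ r) * ((1 ℕ.+ r) * ((1 ℕ.+ r) * 1))
                  ℕ.+ (1 ℕ.+ r) * ((1 ℕ.+ r) * ((1 ℕ.+ r) * ((1 ℕ.+ r) * 1))))
  expanded = solve-∀

q²≡1+r*[q+1] : ∀ r → ℕ.suc r * ℕ.suc r ≡ ℕ.suc (r * (2 ℕ.+ r))
q²≡1+r*[q+1] = expanded
  where
  expanded : ∀ r → (1 ℕ.+ r) * (1 ℕ.+ r) ≡ 1 ℕ.+ r * (2 ℕ.+ r)
  expanded = solve-∀

-- s = (q + 1)(q³ + q) + 1 leaves remainder 1 modulo q + 1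
repunit5≡[q+1]*[q³+q]+1 : ∀ q → repunit5 q ≡ ℕ.suc q * (q ^ 3 ℕ.+ q) ℕ.+ 1
repunit5≡[q+1]*[q³+q]+1 = expanded
  where
  expanded : ∀ q → 1 ℕ.+ q ℕ.+ q * (q * 1) ℕ.+ q * (q * (q * 1)) ℕ.+ q * (q * (q * (q * 1)))
    ≡ (1 ℕ.+ q) * (q * (q * (q * 1)) ℕ.+ q) ℕ.+ 1
  expanded = solve-∀

repunit5-coprime : ∀ q → Coprime (repunit5 q) (ℕ.suc q)
repunit5-coprime q {d} (d∣s , d∣q+1) = ∣1⇒≡1 (∣m+n∣m⇒∣n
  (≡.subst (d ∣_) (repunit5≡[q+1]*[q³+q]+1 q) d∣s) (∣-trans d∣q+1 (m∣m*n (q ^ 3 ℕ.+ q))))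

s≡repunit5 : ∀ m → s (2 ℕ.+ m) ≡ repunit5 (2 ℕ.+ m)
s≡repunit5 m = begin
  ((2 ℕ.+ m) ^ 5 ∸ 1) / ℕ.suc m      ≡⟨ ≡.cong (λ n → (n ∸ 1) / ℕ.suc m) (q⁵≡1+r*s (ℕ.suc m)) ⟩
  ℕ.suc m * repunit5 (2 ℕ.+ m) / ℕ.suc m  ≡⟨ ≡.cong (λ n → n / ℕ.suc m) (ℕ.*-comm (ℕ.suc m) (repunit5 (2 ℕ.+ m))) ⟩
  repunit5 (2 ℕ.+ m) * ℕ.suc m / ℕ.suc m  ≡⟨ m*n/n≡m (repunit5 (2 ℕ.+ m)) (ℕ.suc m) ⟩
  repunit5 (2 ℕ.+ m)                  ∎
  where
  open ≡.≡-Reasoning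

below-not-divisible : ∀ {n i} → 1 ≤ i → i ≤ n ∸ 1 → ¬ n ∣ i
below-not-divisible {ℕ.zero}  1≤i _   0∣i = ℕ.<⇒≢ 1≤i (≡.sym (0∣⇒≡0 0∣i))
below-not-divisible {ℕ.suc n} 1≤i i≤n n∣i = ℕ.<⇒≱ (∣⇒≤ {{ℕ.>-nonZero 1≤i}} n∣i) i≤n

prime-power-≥2 : ∀ {q} → IsPrimePower q → 2 ≤ q
prime-power-≥2 (p , k , p-prime , 1≤k , ≡.refl) = ℕ.≤-trans p≥2 (ℕ.≤-trans
  (ℕ.≤-reflexive (≡.sym (ℕ.*-identityʳ p))) (ℕ.^-monoʳ-≤ p {{ℕ.nonTrivial⇒nonZero p}} 1≤k))
  where
  instance _ = prime⇒nonTrivial p-prime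
  p≥2 = ℕ.nonTrivial⇒n>1 p

injective⇒surjective : ∀ {n} (f : Fin n → Fin n) → Injective _≡_ _≡_ f → ∀ y → ∃[ x ] f x ≡ y
injective⇒surjective {ℕ.suc n} f f-injective y with Fin.any? (λ x → f x Fin.≟ y)
... | yes hit = hit
... | no miss = contradiction (Fin.injective⇒≤ g-injective) ℕ.1+n≰n
  where
  -- if y were missed, f would inject Fin (1 + n) into Fin n
  g : Fin (ℕ.suc n) → Fin n
  g x = punchOut {i = y} (λ y≡fx → miss (x , ≡.sym y≡fx))
  g-injective : Injective _≡_ _≡_ g
  g-injective gx≡gx′ = f-injective (Fin.punchOut-injective {i = y} _ _ gx≡gx′)

injective⇒permutation : ∀ {n} (f : Fin n → Fin n) → Injective _≡_ _≡_ f → Permutation n n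
injective⇒permutation f f-injective =
  permutation f (proj₁ ∘ onto) (proj₂ ∘ onto) (λ x → f-injective (proj₂ (onto (f x))))
  where
  onto = injective⇒surjective f f-injective

-- Finite fields

module FieldTheory {c ℓ : Level} (K : Field c ℓ) where
  open Field K renaming (_*_ to _·_)
  open import Relation.Binary.Reasoning.Setoid setoid
  open import Algebra.Properties.CommutativeMonoid.Sum *-commutativeMonoid
    using (sum-cong-≋; sum-permute) renaming (sum to ∏)
  open import Algebra.Properties.CommutativeSemigroup *-commutativeSemigroup using (interchange)
  open import Algebra.Properties.Group +-group using (inverseʳ-unique; x∙y⁻¹≈ε⇒x≈y)
  open import Algebra.Properties.AbelianGroup +-abelianGroup using (⁻¹-∙-comm)
  open import Algebra.Properties.Ring ring using (-‿distribˡ-*)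
  open import Algebra.Solver.Ring.NaturalCoefficients.Default commutativeSemiring
    using (solve; _:+_; _:*_; _:=_)

  inverse-undoes : ∀ {x x⁻¹} → x · x⁻¹ ≈ 1# → ∀ y → x⁻¹ · (x · y) ≈ y
  inverse-undoes {x} {x⁻¹} xx⁻¹≈1 y = begin
    x⁻¹ · (x · y)  ≈⟨ *-assoc x⁻¹ x y ⟨
    (x⁻¹ · x) · y  ≈⟨ *-congʳ (trans (*-comm x⁻¹ x) xx⁻¹≈1) ⟩
    1# · y         ≈⟨ *-identityˡ y ⟩
    y              ∎

  ·-cancelˡ : ∀ {x y z} → ¬ x ≈ 0# → x · y ≈ x · z → y ≈ z
  ·-cancelˡ {x} {y} {z} x≉0 xy≈xz with x⁻¹ , xx⁻¹≈1 ← inverse x x≉0 =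
    trans (sym (inverse-undoes xx⁻¹≈1 y)) (trans (*-congˡ xy≈xz) (inverse-undoes xx⁻¹≈1 z))

  ·-nonzero : ∀ {x y} → ¬ x ≈ 0# → ¬ y ≈ 0# → ¬ x · y ≈ 0#
  ·-nonzero {x} x≉0 y≉0 xy≈0 = y≉0 (·-cancelˡ x≉0 (trans xy≈0 (sym (zeroʳ x))))

  linear-solution : ∀ {x y z} → ¬ y ≈ 0# → x + y · z ≈ 0# → ∃[ y⁻¹ ] (y · y⁻¹ ≈ 1# × z ≈ y⁻¹ · - x)
  linear-solution {x} {y} {z} y≉0 x+yz≈0 with y⁻¹ , yy⁻¹≈1 ← inverse y y≉0 =
    y⁻¹ , yy⁻¹≈1 , trans (sym (inverse-undoes yy⁻¹≈1 z)) (*-congˡ (inverseʳ-unique x (y · z) x+yz≈0))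

  drop-zero-term : ∀ {x y} z → y ≈ 0# → x + y · z ≈ x
  drop-zero-term {x} z y≈0 = trans (+-congˡ (trans (*-congʳ y≈0) (zeroˡ z))) (+-identityʳ x)

  neg-affine : ∀ x y z → - (x + y · z) ≈ - x + - y · z
  neg-affine x y z = trans (sym (⁻¹-∙-comm x (y · z))) (+-congˡ (-‿distribˡ-* y z))

  affine-difference : ∀ {x y x′ y′ z} → x + y · z ≈ x′ + y′ · z → (x + - x′) + (y + - y′) · z ≈ 0#
  affine-difference {x} {y} {x′} {y′} {z} eq = begin
    (x + - x′) + (y + - y′) · z       ≈⟨ solve 5 (λ x y x′ y′ z → (x :+ x′) :+ (y :+ y′) :* z := (x :+ y :* z) :+ (x′ :+ y′ :* z)) refl x y (- x′) (- y′) z ⟩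
    (x + y · z) + (- x′ + - y′ · z)   ≈⟨ +-cong eq (sym (neg-affine x′ y′ z)) ⟩
    (x′ + y′ · z) + - (x′ + y′ · z)   ≈⟨ -‿inverseʳ _ ⟩
    0#                                ∎

  pow-+ : ∀ x a b → pow K x (a ℕ.+ b) ≈ pow K x a · pow K x b
  pow-+ x ℕ.zero    b = sym (*-identityˡ _)
  pow-+ x (ℕ.suc a) b = trans (*-congˡ (pow-+ x a b)) (sym (*-assoc _ _ _))

  pow-* : ∀ x a b → pow K x (a * b) ≈ pow K (pow K x b) a
  pow-* x ℕ.zero    b = refl
  pow-* x (ℕ.suc a) b = trans (pow-+ x b (a * b)) (*-congˡ (pow-* x a b))

  pow-one : ∀ n → pow K 1# n ≈ 1#
  pow-one ℕ.zero    = refl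
  pow-one (ℕ.suc n) = trans (*-identityˡ _) (pow-one n)

  pow-cong : ∀ {x y} n → x ≈ y → pow K x n ≈ pow K y n
  pow-cong ℕ.zero    x≈y = refl
  pow-cong (ℕ.suc n) x≈y = *-cong x≈y (pow-cong n x≈y)

  pow-nonzero : ∀ {x} n → ¬ x ≈ 0# → ¬ pow K x n ≈ 0#
  pow-nonzero ℕ.zero    x≉0 1≈0 = 0≉1 (sym 1≈0)
  pow-nonzero (ℕ.suc n) x≉0     = ·-nonzero x≉0 (pow-nonzero n x≉0)

  pow-mod : ∀ x k .{{_ : ℕ.NonZero k}} → pow K x k ≈ 1# → ∀ e → pow K x e ≈ pow K x (e % k)
  pow-mod x k xᵏ≈1 e = begin
    pow K x e                                   ≡⟨ ≡.cong (pow K x) (m≡m%n+[m/n]*n e k) ⟩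
    pow K x (e % k ℕ.+ (e / k) * k)             ≈⟨ pow-+ x (e % k) ((e / k) * k) ⟩
    pow K x (e % k) · pow K x ((e / k) * k)     ≈⟨ *-congˡ (pow-* x (e / k) k) ⟩
    pow K x (e % k) · pow K (pow K x k) (e / k) ≈⟨ *-congˡ (trans (pow-cong (e / k) xᵏ≈1) (pow-one (e / k))) ⟩
    pow K x (e % k) · 1#                        ≈⟨ *-identityʳ _ ⟩
    pow K x (e % k)                             ∎

  ∏-nonzero : ∀ {n} (t : Fin n → Carrier) → (∀ i → ¬ t i ≈ 0#) → ¬ ∏ t ≈ 0#
  ∏-nonzero {ℕ.zero}  t t≉0 1≈0 = 0≉1 (sym 1≈0)
  ∏-nonzero {ℕ.suc n} t t≉0     = ·-nonzero (t≉0 Fin.zero) (∏-nonzero (t ∘ Fin.suc) (t≉0 ∘ Fin.suc))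

  ∏-scale : ∀ {n} β (t : Fin n → Carrier) → ∏ (λ i → β · t i) ≈ pow K β n · ∏ t
  ∏-scale {ℕ.zero}  β t = sym (*-identityˡ _)
  ∏-scale {ℕ.suc n} β t = begin
    (β · t Fin.zero) · ∏ (λ i → β · t (Fin.suc i))   ≈⟨ *-congˡ (∏-scale β (t ∘ Fin.suc)) ⟩
    (β · t Fin.zero) · (pow K β n · ∏ (t ∘ Fin.suc))  ≈⟨ interchange _ _ _ _ ⟩
    (β · pow K β n) · (t Fin.zero · ∏ (t ∘ Fin.suc))  ∎

  -- Finite subsets, given by an enumeration without repetition

  record Enum {p} (P : Carrier → Set p) (n : ℕ) : Set (c ⊔ ℓ ⊔ p) where
    field
      at        : Fin n → Carrier
      injective : ∀ {i j} → at i ≈ at j → i ≡ j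
      member    : ∀ i → P (at i)
      cover     : ∀ {x} → P x → ∃[ i ] (at i ≈ x)

  Everything : Carrier → Set
  Everything _ = ⊤

  Nonzero : ∀ {p} → (Carrier → Set p) → Carrier → Set (ℓ ⊔ p)
  Nonzero P x = P x × ¬ x ≈ 0#

  card⇒enum : ∀ {n} → HasCard K n → Enum Everything n
  card⇒enum card = record
    { at = to ; injective = injective ; member = λ _ → tt
    ; cover = λ {x} _ → proj₁ (surjective x) , proj₂ (surjective x) ≡.refl }
    where open Bijection card

  subfield-card⇒enum : ∀ {S n} → IsSubfieldOfCard K S n → Enum S n
  subfield-card⇒enum S-card = record
    { at = proj₁ ∘ to ; injective = injective ; member = proj₂ ∘ to
    ; cover = λ {x} Sx → proj₁ (surjective (x , Sx)) , proj₂ (surjective (x , Sx)) ≡.refl }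
    where open Bijection (IsSubfieldOfCard.card S-card)

  -- a finite field has decidable equality: compare the indices of the two elements
  enum-decidable : ∀ {n} → Enum Everything n → Decidable _≈_
  enum-decidable E x y with i , i≈x ← Enum.cover E {x} tt | j , j≈y ← Enum.cover E {y} tt | i Fin.≟ j
  ... | yes ≡.refl = yes (trans (sym i≈x) j≈y)
  ... | no  i≢j    = no (λ x≈y → i≢j (Enum.injective E (trans i≈x (trans x≈y (sym j≈y)))))

  remove-zero : ∀ {p} {P : Carrier → Set p} {n} → Enum P (ℕ.suc n) → P 0# → Enum (Nonzero P) n
  remove-zero {P = P} {n} E P0 = record
    { at = at ∘ punchIn z
    ; injective = Fin.punchIn-injective z _ _ ∘ injective
    ; member = λ i → member (punchIn z i) , λ i≈0 → Fin.punchInᵢ≢i z i (injective (trans i≈0 (sym z≈0)))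
    ; cover = cover-nonzero }
    where
    open Enum E
    z = proj₁ (cover P0)
    z≈0 = proj₂ (cover P0)
    cover-nonzero : ∀ {x} → Nonzero P x → ∃[ i ] (at (punchIn z i) ≈ x)
    cover-nonzero (Px , x≉0) with i , i≈x ← cover Px =
      punchOut z≢i , trans (reflexive (≡.cong at (Fin.punchIn-punchOut z≢i))) i≈x
      where
      z≢i : z ≢ i
      z≢i z≡i = x≉0 (trans (sym i≈x) (trans (reflexive (≡.cong at (≡.sym z≡i))) z≈0))

  -- Lagrange: if multiplication by β ≠ 0 maps P into P, it permutes the n nonzero elements
  -- of P, and comparing their products gives βⁿ = 1
  lagrange : ∀ {p} {P : Carrier → Set p} {n} → Enum (Nonzero P) n →
             ∀ {β} → ¬ β ≈ 0# → (∀ {x} → P x → P (β · x)) → pow K β n ≈ 1#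
  lagrange {n = n} E {β} β≉0 closed = ·-cancelˡ (∏-nonzero at (proj₂ ∘ member)) (begin
    ∏ at · pow K β n      ≈⟨ *-comm _ _ ⟩
    pow K β n · ∏ at      ≈⟨ ∏-scale β at ⟨
    ∏ (λ i → β · at i)    ≈⟨ sum-cong-≋ (λ i → sym (proj₂ (image i))) ⟩
    ∏ (at ∘ π)            ≈⟨ sum-permute at (injective⇒permutation π π-injective) ⟨
    ∏ at                  ≈⟨ *-identityʳ _ ⟨
    ∏ at · 1#             ∎)
    where
    open Enum E
    image : ∀ i → ∃[ j ] (at j ≈ β · at i)
    image i = cover (closed (proj₁ (member i)) , ·-nonzero β≉0 (proj₂ (member i)))
    π : Fin n → Fin n
    π = proj₁ ∘ image
    π-injective : Injective _≡_ _≡_ π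
    π-injective {i} {j} πi≡πj = injective (·-cancelˡ β≉0
      (trans (sym (proj₂ (image i))) (trans (reflexive (≡.cong at πi≡πj)) (proj₂ (image j)))))

  -- an element α generating all nonzero elements, with αᵏ = 1, yields at most k of them:
  -- the exponent modulo k determines the element
  generator-bound : ∀ {N α} → Enum (Nonzero Everything) N → IsPrimitive K α →
                    ∀ k .{{_ : ℕ.NonZero k}} → pow K α k ≈ 1# → N ≤ k
  generator-bound {N} {α} E (_ , generates) k αᵏ≈1 = Fin.injective⇒≤ residue-injective
    where
    open Enum E
    exponent : ∀ i → ∃[ e ] (at i ≈ pow K α e)
    exponent i = generates (at i) (proj₂ (member i))
    residue : Fin N → Fin k
    residue i = Fin.fromℕ< (m%n<n (proj₁ (exponent i)) k)
    same-power : ∀ i → at i ≈ pow K α (proj₁ (exponent i) % k)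
    same-power i = trans (proj₂ (exponent i)) (pow-mod α k αᵏ≈1 (proj₁ (exponent i)))
    residue-injective : Injective _≡_ _≡_ residue
    residue-injective {i} {j} ri≡rj = injective (trans (same-power i) (trans
      (reflexive (≡.cong (pow K α) (Fin.fromℕ<-injective _ _ _ _ ri≡rj))) (sym (same-power j))))

  primitive-order : ∀ {N α} → Enum (Nonzero Everything) N → IsPrimitive K α →
                    ∀ e → pow K α e ≈ 1# → N ∣ e
  primitive-order {ℕ.zero} E (α≉0 , _) e _ with () ← proj₁ (Enum.cover E (tt , α≉0))
  primitive-order {N@(ℕ.suc _)} {α} E prim e αᵉ≈1 with e % N in e%N≡r
  ... | ℕ.zero    = m%n≡0⇒n∣m e N e%N≡r
  ... | r@(ℕ.suc _) = contradiction (generator-bound E prim r αʳ≈1) (ℕ.<⇒≱ r<N)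
    where
    r<N : r ℕ.< N
    r<N = ≡.subst (ℕ._< N) e%N≡r (m%n<n e N)
    αʳ≈1 : pow K α r ≈ 1#
    αʳ≈1 = trans (reflexive (≡.cong (pow K α) (≡.sym e%N≡r)))
                 (trans (sym (pow-mod α N (lagrange E (proj₁ prim) (λ _ → tt)) e)) αᵉ≈1)

  module Subfield (S : Carrier → Set ℓ) (S-subfield : IsSubfield K S) where
    open IsSubfield S-subfield

    isolate : ∀ {x y z} → S x → S y → ¬ y ≈ 0# → x + y · z ≈ 0# → S z
    isolate Sx Sy y≉0 x+yz≈0 with y⁻¹ , yy⁻¹≈1 , z≈ ← linear-solution y≉0 x+yz≈0 =
      resp (sym z≈) (*-closed (inv-closed Sy yy⁻¹≈1) (neg-closed Sx))

    Span : Carrier → Carrier → Set (c ⊔ ℓ)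
    Span β z = ∃[ x ] ∃[ y ] (S x × S y × z ≈ x + y · β)

    span-zero : ∀ {β} → Span β 0#
    span-zero {β} = 0# , 0# , has0 , has0 , sym (drop-zero-term β refl)

    span-closed : ∀ {β u v} → S u → S v → β · β ≈ u + v · β → ∀ {z} → Span β z → Span β (β · z)
    span-closed {β} {u} {v} Su Sv β²≈ {z} (x , y , Sx , Sy , z≈) =
      y · u , x + y · v , *-closed Sy Su , +-closed Sx (*-closed Sy Sv) , (begin
        β · z                   ≈⟨ *-congˡ z≈ ⟩
        β · (x + y · β)         ≈⟨ solve 3 (λ β x y → β :* (x :+ y :* β) := x :* β :+ y :* (β :* β)) refl β x y ⟩
        x · β + y · (β · β)     ≈⟨ +-congˡ (*-congˡ β²≈) ⟩
        x · β + y · (u + v · β) ≈⟨ solve 5 (λ β x y u v → x :* β :+ y :* (u :+ v :* β) := y :* u :+ (x :+ y :* v) :* β) refl β x y u v ⟩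
        y · u + (x + y · v) · β ∎)

    span-unique : Decidable _≈_ → ∀ {β x y x′ y′} → ¬ S β → S x → S y → S x′ → S y′ →
                  x + y · β ≈ x′ + y′ · β → x ≈ x′ × y ≈ y′
    span-unique _≟_ {β} {x} {y} {x′} {y′} β∉S Sx Sy Sx′ Sy′ eq with (y + - y′) ≟ 0#
    ... | no δ≉0 = ⊥-elim (β∉S (isolate (+-closed Sx (neg-closed Sx′)) (+-closed Sy (neg-closed Sy′)) δ≉0
                                        (affine-difference eq)))
    ... | yes δ≈0 = x∙y⁻¹≈ε⇒x≈y x x′ (trans (sym (drop-zero-term β δ≈0)) (affine-difference eq)) ,
                    x∙y⁻¹≈ε⇒x≈y y y′ δ≈0

    span-enum : Decidable _≈_ → ∀ {β q} → ¬ S β → Enum S q → Enum (Span β) (q * q)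
    span-enum _≟_ {β} {q} β∉S ES = record
      { at = point ∘ remQuot q
      ; injective = injective
      ; member = λ k → let (a , b) = remQuot q k in E.at a , E.at b , E.member a , E.member b , refl
      ; cover = cover }
      where
      module E = Enum ES
      point : Fin q × Fin q → Carrier
      point (a , b) = E.at a + E.at b · β
      point-injective : ∀ {a b a′ b′} → point (a , b) ≈ point (a′ , b′) → (a , b) ≡ (a′ , b′)
      point-injective {a} {b} {a′} {b′} eq
        with a≈a′ , b≈b′ ← span-unique _≟_ β∉S (E.member a) (E.member b) (E.member a′) (E.member b′) eq
        with ≡.refl ← E.injective a≈a′ | ≡.refl ← E.injective b≈b′ = ≡.refl
      injective : ∀ {k k′} → point (remQuot q k) ≈ point (remQuot q k′) → k ≡ k′
      injective {k} {k′} eq = ≡.trans (≡.sym (Fin.combine-remQuot {q} q k))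
        (≡.trans (≡.cong (uncurry combine) (point-injective eq)) (Fin.combine-remQuot {q} q k′))
      cover : ∀ {z} → Span β z → ∃[ k ] (point (remQuot q k) ≈ z)
      cover (x , y , Sx , Sy , z≈) with a , a≈x ← E.cover Sx | b , b≈y ← E.cover Sy =
        combine a b , (begin
          point (remQuot q (combine a b)) ≡⟨ ≡.cong point (Fin.remQuot-combine a b) ⟩
          E.at a + E.at b · β             ≈⟨ +-cong a≈x (*-congʳ b≈y) ⟩
          x + y · β                       ≈⟨ z≈ ⟨
          _                               ∎)

module Independence {c ℓ : Level} (K : Field c ℓ) (r s : ℕ) .{{_ : ℕ.NonZero r}}
  (K-enum : FieldTheory.Enum K (FieldTheory.Everything K) (ℕ.suc (r * s)))
  (S : Field.Carrier K → Set ℓ) (S-subfield : IsSubfield K S) (S-enum : FieldTheory.Enum K S (ℕ.suc r))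
  (α : Field.Carrier K) (α-primitive : IsPrimitive K α)
  (i : ℕ) (s∤i : ¬ s ∣ i) (s⊥q+1 : Coprime s (2 ℕ.+ r)) where

  open Field K renaming (_*_ to _·_)
  open FieldTheory K
  open Subfield S S-subfield
  open IsSubfield S-subfield
  open import Relation.Binary.Reasoning.Setoid setoid
  open import Algebra.Solver.Ring.NaturalCoefficients.Default commutativeSemiring
    using (solve; _:+_; _:*_; _:=_)

  β : Carrier
  β = pow K α i

  β≉0 : ¬ β ≈ 0#
  β≉0 = pow-nonzero i (proj₁ α-primitive)

  _≟_ : Decidable _≈_
  _≟_ = enum-decidable K-enum

  -- as α has order r s, a relation β^(r n) = 1 forces s ∣ n i
  order-bound : ∀ n → pow K β (r * n) ≈ 1# → s ∣ n * i
  order-bound n βʳⁿ≈1 = *-cancelˡ-∣ r (≡.subst (r * s ∣_) (ℕ.*-assoc r n i)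
    (primitive-order (remove-zero K-enum tt) α-primitive (r * n * i) (trans (pow-* α (r * n) i) βʳⁿ≈1)))

  -- β ∉ S, since otherwise β^(q - 1) = 1 by Lagrange in S
  β∉S : ¬ S β
  β∉S Sβ = s∤i (≡.subst (s ∣_) (ℕ.*-identityˡ i) (order-bound 1 (trans
    (reflexive (≡.cong (pow K β) (ℕ.*-identityʳ r))) (lagrange (remove-zero S-enum has0) β≉0 (*-closed Sβ)))))

  -- β is not quadratic over S, since otherwise β^(q² - 1) = 1 by Lagrange in the span of 1, β
  β-not-quadratic : ∀ {u v} → S u → S v → ¬ β · β ≈ u + v · β
  β-not-quadratic Su Sv β²≈ = s∤i (coprime-divisor s⊥q+1 (order-bound (2 ℕ.+ r) βᵐ≈1))
    where
    span-enum′ = ≡.subst (Enum (Span β)) (q²≡1+r*[q+1] r) (span-enum _≟_ β∉S S-enum)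
    βᵐ≈1 = lagrange (remove-zero span-enum′ span-zero) β≉0 (span-closed Su Sv β²≈)

  β²≈β·β : pow K α (2 * i) ≈ β · β
  β²≈β·β = trans (pow-+ α i (i ℕ.+ 0)) (*-congˡ (reflexive (≡.cong (pow K α) (ℕ.+-identityʳ i))))

  independent : LinIndep3 K S (pow K α 0) β (pow K α (2 * i))
  independent a b d Sa Sb Sd relation with d ≟ 0#
  ... | no d≉0 with d⁻¹ , dd⁻¹≈1 , β²≈ ← linear-solution d≉0 (trans (+-congˡ (*-congˡ (sym β²≈β·β))) relation) =
    ⊥-elim (β-not-quadratic (*-closed Sd⁻¹ (neg-closed (*-closed Sa has1))) (*-closed Sd⁻¹ (neg-closed Sb)) (begin
      β · β                                 ≈⟨ β²≈ ⟩
      d⁻¹ · - (a · 1# + b · β)              ≈⟨ *-congˡ (neg-affine (a · 1#) b β) ⟩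
      d⁻¹ · (- (a · 1#) + - b · β)          ≈⟨ solve 4 (λ d⁻¹ x y β → d⁻¹ :* (x :+ y :* β) := d⁻¹ :* x :+ (d⁻¹ :* y) :* β) refl d⁻¹ (- (a · 1#)) (- b) β ⟩
      d⁻¹ · - (a · 1#) + d⁻¹ · - b · β      ∎))
    where Sd⁻¹ = inv-closed Sd dd⁻¹≈1
  ... | yes d≈0 with b ≟ 0#
  ...   | no b≉0  = ⊥-elim (β∉S (isolate (*-closed Sa has1) Sb b≉0 linear))
    where linear = trans (sym (drop-zero-term (pow K α (2 * i)) d≈0)) relation
  ...   | yes b≈0 = trans (sym (*-identityʳ a)) (trans (sym (drop-zero-term β b≈0))
                      (trans (sym (drop-zero-term (pow K α (2 * i)) d≈0)) relation)) , b≈0 , d≈0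

lemma5 : ∀ {c ℓ : Level} (q : ℕ) → IsPrimePower q →
    (K : Field c ℓ) → HasCard K (q ^ 5) →
    (S : Field.Carrier K → Set ℓ) → IsSubfieldOfCard K S q →
    (α : Field.Carrier K) → IsPrimitive K α →
    (i : ℕ) → 1 ≤ i → i ≤ s q ∸ 1 →
    LinIndep3 K S (pow K α 0) (pow K α i) (pow K α (2 * i))
lemma5 ℕ.zero q-pp with () ← prime-power-≥2 q-pp
lemma5 (ℕ.suc ℕ.zero) q-pp with ℕ.s≤s () ← prime-power-≥2 q-pp
lemma5 q@(ℕ.suc (ℕ.suc m)) _ K K-card S S-card α α-primitive i 1≤i i<s =
  Independence.independent K (ℕ.suc m) (repunit5 q) K-enum S (IsSubfieldOfCard.isSubfield S-card)
    (subfield-card⇒enum K S-card) α α-primitive i s∤i (repunit5-coprime q)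
  where
  open FieldTheory using (card⇒enum; subfield-card⇒enum; Enum; Everything)
  K-enum = ≡.subst (Enum K (Everything K)) (q⁵≡1+r*s (ℕ.suc m)) (card⇒enum K K-card)
  s∤i = below-not-divisible 1≤i (≡.subst (λ n → i ≤ n ∸ 1) (s≡repunit5 m) i<s)
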